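{- Let $G$ be a finite simple graph with $\mathrm{diam}(G)=3$ such that $D_2(G)$ is connected. Then $\mathrm{diam}(D_2(G))\leqslant 5$.
   Context: All graphs are finite, simple and undirected. For a graph $H$, $\mathrm{diam}(H)$ is the maximum over pairs of vertices of the length of a shortest path between them. The $2$-distance graph $D_2(G)$ has vertex set $V(G)$, two vertices being adjacent if and only if their distance in $G$ is exactly $2$. -}

module Defs where

open import Data.Nat using (ℕ; zero; suc; _<_; _≤_)
open import Data.Fin using (Fin)
open import Data.Bool using (Bool; true; false)
open import Data.Product using (Σ; _×_; ∃; ∃-syntax)
open import Relation.Binary.PropositionalEquality using (_≡_)
open import Relation.Nullary using (¬_)

record Graph (n : ℕ) : Set where
  field
    adj   : Fin n → Fin n → Bool
    sym   : ∀ u v → adj u v ≡ adj v u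
    irrefl : ∀ v → adj v v ≡ false
open Graph public

data Walk {n : ℕ} (R : Fin n → Fin n → Set) : ℕ → Fin n → Fin n → Set where
  nil  : ∀ {v} → Walk R zero v v
  cons : ∀ {k u w v} → R u w → Walk R k w v → Walk R (suc k) u v

Dist : {n : ℕ} → (Fin n → Fin n → Set) → Fin n → Fin n → ℕ → Set
Dist R u v d = Walk R d u v × (∀ m → m < d → ¬ Walk R m u v)

Connected : {n : ℕ} → (Fin n → Fin n → Set) → Set
Connected R = ∀ u v → ∃[ k ] Walk R k u v

DiamLe : {n : ℕ} → (Fin n → Fin n → Set) → ℕ → Set
DiamLe R d = ∀ u v → ∃[ m ] (m ≤ d × Walk R m u v)

DiamEq : {n : ℕ} → (Fin n → Fin n → Set) → ℕ → Set
DiamEq R d = DiamLe R d × ∃[ u ] ∃[ v ] Dist R u v d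

Adj : {n : ℕ} → Graph n → Fin n → Fin n → Set
Adj G u v = adj G u v ≡ true

D₂ : {n : ℕ} → Graph n → Fin n → Fin n → Set
D₂ G u v = Dist (Adj G) u v 2

-- Suppose d(u,v) = 3 and call w near u if w = u, D u w, or w ~ u with d(v,w) = 3.
-- A vertex at distance 3 from both u and v yields a D-walk of length at most 4
-- directly; every other vertex is near u or near v.  A D-edge from a vertex near
-- u to one near v also closes such a walk: a neighbour of u at distance 3 from v
-- reaches u in two D-steps (or u and v are already close), and if both ends are of
-- that kind, their common neighbour is D-adjacent to u and to v.  The first step
-- of a D-path from u to v that leaves the vertices near u is such an edge.
--
-- Suppose u ~ v.  Since diam(G) = 3 some a, b with d(a,b) = 3 straddle the edge:
-- a ~ v, d(u,a) = 2, b ~ u, d(v,b) = 2 (unless a short D-walk appears on the way).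
-- Then every vertex is within two D-steps of u or of v; for a common neighbour w
-- of u and v this goes through a if w ~ b and through b otherwise.  The first step
-- of a D-path from u to v that leaves the D-ball of radius 2 around u gives a
-- D-walk of length at most 2 + 1 + 2.
module Submission where

open import Defs hiding (sym)
open import Data.Nat using (ℕ; zero; suc; _+_; _≤_; z≤n; s≤s; _≤ᵇ_)
open import Data.Nat.Properties using (≤-refl; ≤-trans; ≤ᵇ⇒≤; +-mono-≤)
open import Data.Fin using (Fin; _≟_)
open import Data.Fin.Properties using (any?)
open import Data.Bool using (true; T)
import Data.Bool as Bool
open import Data.Product using (_×_; _,_; ∃-syntax; proj₂)
open import Data.Sum using (_⊎_; inj₁; inj₂)
open import Data.Empty using (⊥; ⊥-elim)
open import Relation.Nullary using (¬_; Dec; yes; no; contradiction)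
open import Relation.Nullary.Decidable using (_×-dec_)
open import Relation.Binary.PropositionalEquality using (_≡_; _≢_; refl; sym; trans)

module _ {n : ℕ} {R : Fin n → Fin n → Set} where

  _++ʷ_ : ∀ {a b u v w} → Walk R a u v → Walk R b v w → Walk R (a + b) u w
  nil      ++ʷ q = q
  cons e p ++ʷ q = cons e (p ++ʷ q)

  _∷ʳ_ : ∀ {k u v w} → Walk R k u v → R v w → Walk R (suc k) u w
  nil      ∷ʳ f = cons f nil
  cons e p ∷ʳ f = cons e (p ∷ʳ f)

  reverseʷ : (∀ {u v} → R u v → R v u) → ∀ {k u v} → Walk R k u v → Walk R k v u
  reverseʷ R-sym nil        = nil
  reverseʷ R-sym (cons e p) = reverseʷ R-sym p ∷ʳ R-sym e

  along-walk : ∀ {P : Fin n → Set} {A : Set} →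
               (∀ {w w'} → P w → R w w' → A ⊎ P w') →
               ∀ {k u v} → (P v → A) → Walk R k u v → P u → A
  along-walk step end nil        pu = end pu
  along-walk step end (cons e p) pu with step pu e
  ... | inj₁ a  = a
  ... | inj₂ pw = along-walk step end p pw

-- DiamLe R d unfolds to ∀ u v → Within R d u v.
Within : {n : ℕ} → (Fin n → Fin n → Set) → ℕ → Fin n → Fin n → Set
Within R k u v = ∃[ m ] (m ≤ k × Walk R m u v)

module _ {n : ℕ} {R : Fin n → Fin n → Set} where

  within-refl : ∀ {k u} → Within R k u u
  within-refl = 0 , z≤n , nil

  edge : ∀ {u v} → R u v → Within R 1 u v
  edge e = 1 , s≤s z≤n , cons e nil

  infixr 5 _⊕_
  _⊕_ : ∀ {a b u v w} → Within R a u v → Within R b v w → Within R (a + b) u w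
  (m , m≤a , p) ⊕ (m' , m'≤b , q) = m + m' , +-mono-≤ m≤a m'≤b , p ++ʷ q

  weaken : ∀ {a b u v} {_ : T (a ≤ᵇ b)} → Within R a u v → Within R b u v
  weaken {a} {b} {_} {_} {a≤b} (m , m≤a , p) = m , ≤-trans m≤a (≤ᵇ⇒≤ a b a≤b) , p

  within-reverse : (∀ {u v} → R u v → R v u) → ∀ {k u v} → Within R k u v → Within R k v u
  within-reverse R-sym (m , m≤k , p) = m , m≤k , reverseʷ R-sym p

  within₁-split : ∀ {u v} → Within R 1 u v → u ≡ v ⊎ R u v
  within₁-split (0 , _ , nil)        = inj₁ refl
  within₁-split (1 , _ , cons e nil) = inj₂ e
  within₁-split (suc (suc _) , s≤s () , _)

  Dist⇒within : ∀ {k u v} → Dist R u v k → Within R k u v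
  Dist⇒within {k} (p , _) = k , ≤-refl , p

  Dist-1⇒R : ∀ {u v} → Dist R u v 1 → R u v
  Dist-1⇒R (cons e nil , _) = e

  -- The implicit argument computes to ⊤ for literal m and k with m < k, so such
  -- contradictions need no arithmetic.
  shortcut : ∀ {k m u v} → Dist R u v k → Within R m u v → {_ : T (suc m ≤ᵇ k)} → ⊥
  shortcut {k} {m} (_ , shortest) (l , l≤m , p) {m<k} =
    shortest l (≤-trans (s≤s l≤m) (≤ᵇ⇒≤ (suc m) k m<k)) p

  triangle : ∀ {x y z a b c} → Dist R a b x → Dist R b c y → Dist R a c z →
             {_ : T (suc (x + y) ≤ᵇ z)} → ⊥
  triangle ab bc ac {x+y<z} = shortcut ac (Dist⇒within ab ⊕ Dist⇒within bc) {x+y<z}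

  Dist-sym : (∀ {u v} → R u v → R v u) → ∀ {k u v} → Dist R u v k → Dist R v u k
  Dist-sym R-sym (p , shortest) =
    reverseʷ R-sym p , λ m m<k q → shortest m m<k (reverseʷ R-sym q)

  Dist-step : ∀ {k u v} → Dist R u v (suc k) → ∃[ w ] (R u w × Dist R w v k)
  Dist-step (cons {w = w} e p , shortest) =
    w , e , p , λ m m<k q → shortest (suc m) (s≤s m<k) (cons e q)

  Dist-1-intro : ∀ {u v} → u ≢ v → R u v → Dist R u v 1
  Dist-1-intro u≢v e = cons e nil , λ { zero _ nil → u≢v refl ; (suc _) (s≤s ()) _ }

  Dist-2-intro : ∀ {u w v} → u ≢ v → ¬ R u v → R u w → R w v → Dist R u v 2
  Dist-2-intro u≢v u≁v e f = cons e (cons f nil) , λ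
    { zero _ nil → u≢v refl
    ; (suc zero) _ (cons g nil) → u≁v g
    ; (suc (suc _)) (s≤s (s≤s ())) _ }

  Dist-3-intro : ∀ {u v} → u ≢ v → ¬ R u v → (∀ {w} → R u w → ¬ R w v) → Walk R 3 u v →
                 Dist R u v 3
  Dist-3-intro u≢v u≁v no-common p = p , λ
    { zero _ nil → u≢v refl
    ; (suc zero) _ (cons g nil) → u≁v g
    ; (suc (suc zero)) _ (cons g (cons h nil)) → no-common g h
    ; (suc (suc (suc _))) (s≤s (s≤s (s≤s ()))) _ }

module Diameter≤3 {n : ℕ} (G : Graph n) (diam≤3 : DiamLe (Adj G) 3) where

  V : Set
  V = Fin n

  _~_ : V → V → Set
  _~_ = Adj G

  _~?_ : ∀ u v → Dec (u ~ v)
  u ~? v = adj G u v Bool.≟ true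

  ~-sym : ∀ {u v} → u ~ v → v ~ u
  ~-sym {u} {v} e = trans (Graph.sym G v u) e

  ~-irrefl : ∀ {u} → ¬ u ~ u
  ~-irrefl {u} e with trans (sym e) (Graph.irrefl G u)
  ... | ()

  ~⇒Dist-1 : ∀ {u v} → u ~ v → Dist _~_ u v 1
  ~⇒Dist-1 e = Dist-1-intro (λ { refl → ~-irrefl e }) e

  dist-sym : ∀ {k u v} → Dist _~_ u v k → Dist _~_ v u k
  dist-sym = Dist-sym ~-sym

  common-neighbour? : ∀ u v → Dec (∃[ w ] (u ~ w × w ~ v))
  common-neighbour? u v = any? λ w → (u ~? w) ×-dec (w ~? v)

  data DistView (u v : V) : Set where
    is0 : Dist _~_ u v 0 → DistView u v
    is1 : Dist _~_ u v 1 → DistView u v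
    is2 : Dist _~_ u v 2 → DistView u v
    is3 : Dist _~_ u v 3 → DistView u v

  view : ∀ u v → DistView u v
  view u v with u ≟ v
  ... | yes refl = is0 (nil , λ _ ())
  ... | no u≢v with u ~? v
  ...   | yes e = is1 (Dist-1-intro u≢v e)
  ...   | no u≁v with common-neighbour? u v
  ...     | yes (_ , e , f) = is2 (Dist-2-intro u≢v u≁v e f)
  ...     | no ¬common with diam≤3 u v
  ...       | 0 , _ , nil                 = contradiction refl u≢v
  ...       | 1 , _ , cons e nil          = contradiction e u≁v
  ...       | 2 , _ , cons e (cons f nil) = contradiction (_ , e , f) ¬common
  ...       | 3 , _ , p = is3 (Dist-3-intro u≢v u≁v (λ e f → ¬common (_ , e , f)) p)
  ...       | suc (suc (suc (suc _))) , s≤s (s≤s (s≤s ())) , _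

  D : V → V → Set
  D = D₂ G

  geodesic-D : ∀ {a w m c} → a ~ w → w ~ m → m ~ c → Dist _~_ a c 3 → D a m
  geodesic-D aw wm mc ac =
    Dist-2-intro (λ { refl → shortcut ac (edge mc) })
                 (λ am → shortcut ac (edge am ⊕ edge mc))
                 aw wm

  neighbour-of-antipode : ∀ {u v y} → Dist _~_ u v 3 → Dist _~_ u y 3 → y ~ v →
                          Within D 4 u v ⊎ Within D 2 y v
  neighbour-of-antipode {v = v} uv uy yv with Dist-step (dist-sym uy)
  ... | p , yp , pu with view v p
  ...   | is0 e = ⊥-elim (triangle (dist-sym pu) (dist-sym e) uv)
  ...   | is2 e = inj₁ (weaken (edge (dist-sym pu) ⊕ edge (dist-sym e)))
  ...   | is3 e = ⊥-elim (triangle (~⇒Dist-1 (~-sym yv)) (~⇒Dist-1 yp) e)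
  ...   | is1 e with Dist-step pu
  ...     | q , pq , qu with view v q
  ...       | is0 f = ⊥-elim (triangle (dist-sym qu) (dist-sym f) uv)
  ...       | is1 f = ⊥-elim (triangle (dist-sym qu) (dist-sym f) uv)
  ...       | is3 f = ⊥-elim (triangle e (~⇒Dist-1 pq) f)
  ...       | is2 f =
    inj₂ (edge (geodesic-D yp pq (Dist-1⇒R qu) (dist-sym uy)) ⊕ edge (dist-sym f))

  data Near (a b w : V) : Set where
    close  : Within D 1 a w → Near a b w
    beside : a ~ w → Dist _~_ b w 3 → Near a b w

  near-D-near : ∀ {u v w w'} → Dist _~_ u v 3 → Near u v w → D w w' → Near v u w' →
                Within D 4 u v
  near-D-near uv (close p) d (close q) = weaken (p ⊕ edge d ⊕ within-reverse dist-sym q)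
  near-D-near uv (close p) d (beside vw' uw') with neighbour-of-antipode uv uw' (~-sym vw')
  ... | inj₁ r = r
  ... | inj₂ q = p ⊕ edge d ⊕ q
  near-D-near uv (beside uw vw) d (close q) with neighbour-of-antipode (dist-sym uv) vw (~-sym uw)
  ... | inj₁ r = within-reverse dist-sym r
  ... | inj₂ p = within-reverse dist-sym p ⊕ edge d ⊕ within-reverse dist-sym q
  near-D-near uv (beside uw vw) (cons wm (cons mw' nil) , _) (beside vw' uw') =
    weaken (edge (geodesic-D uw wm mw' uw')
            ⊕ edge (dist-sym (geodesic-D vw' (~-sym mw') (~-sym wm) vw)))

  common-antipode : ∀ {u v z} → Dist _~_ u v 3 → Dist _~_ u z 3 → Dist _~_ v z 3 →
                    Within D 4 u v
  common-antipode {u} {v} uv uz vz with Dist-step (dist-sym uz) | Dist-step (dist-sym vz)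
  ... | r , zr , ru | s , zs , sv with view v r | view u s
  ...   | is0 e | _ = ⊥-elim (triangle e (~⇒Dist-1 (~-sym zr)) vz)
  ...   | is1 e | _ = ⊥-elim (triangle e (~⇒Dist-1 (~-sym zr)) vz)
  ...   | is2 e | _ = weaken (edge (dist-sym ru) ⊕ edge (dist-sym e))
  ...   | is3 _ | is0 e = ⊥-elim (triangle e (~⇒Dist-1 (~-sym zs)) uz)
  ...   | is3 _ | is1 e = ⊥-elim (triangle e (~⇒Dist-1 (~-sym zs)) uz)
  ...   | is3 _ | is2 e = weaken (edge e ⊕ edge sv)
  ...   | is3 vr | is3 us with r ~? s
  ...     | no r≁s =
    near-D-near uv (close (edge (dist-sym ru))) (Dist-2-intro r≢s r≁s (~-sym zr) zs)
                (close (edge (dist-sym sv)))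
    where
    r≢s : r ≢ s
    r≢s refl = shortcut us (Dist⇒within (dist-sym ru))
  ...     | yes r~s with Dist-step ru | Dist-step sv
  ...       | w₁ , rw₁ , w₁u | w₂ , sw₂ , w₂v with view v w₁ | view u w₂
  ...         | is0 e | _ = ⊥-elim (triangle (dist-sym w₁u) (dist-sym e) uv)
  ...         | is1 e | _ = ⊥-elim (triangle (dist-sym w₁u) (dist-sym e) uv)
  ...         | _ | is0 e = ⊥-elim (triangle e w₂v uv)
  ...         | _ | is1 e = ⊥-elim (triangle e w₂v uv)
  ...         | is3 e | _ =
    near-D-near uv (beside (~-sym (Dist-1⇒R w₁u)) e)
                (dist-sym (geodesic-D (~-sym r~s) rw₁ (Dist-1⇒R w₁u) (dist-sym us)))
                (close (edge (dist-sym sv)))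
  ...         | _ | is3 e =
    near-D-near uv (close (edge (dist-sym ru)))
                (geodesic-D r~s sw₂ (Dist-1⇒R w₂v) (dist-sym vr))
                (beside (~-sym (Dist-1⇒R w₂v)) e)
  ...         | is2 f | is2 e =
    edge e
    ⊕ edge (dist-sym (geodesic-D zs sw₂ (Dist-1⇒R w₂v) (dist-sym vz)))
    ⊕ edge (geodesic-D zr rw₁ (Dist-1⇒R w₁u) (dist-sym uz))
    ⊕ edge (dist-sym f)

  near-either : ∀ {u v} → Dist _~_ u v 3 → ∀ w → Within D 4 u v ⊎ Near u v w ⊎ Near v u w
  near-either {u} {v} uv w with view u w
  ... | is0 (nil , _) = inj₂ (inj₁ (close within-refl))
  ... | is2 e = inj₂ (inj₁ (close (edge e)))
  ... | is1 e with view v w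
  ...   | is0 f = ⊥-elim (triangle e (dist-sym f) uv)
  ...   | is1 f = ⊥-elim (triangle e (dist-sym f) uv)
  ...   | is2 f = inj₂ (inj₂ (close (edge f)))
  ...   | is3 f = inj₂ (inj₁ (beside (Dist-1⇒R e) f))
  near-either {u} {v} uv w | is3 e with view v w
  ...   | is0 (nil , _) = inj₂ (inj₂ (close within-refl))
  ...   | is1 f = inj₂ (inj₂ (beside (Dist-1⇒R f) e))
  ...   | is2 f = inj₂ (inj₂ (close (edge f)))
  ...   | is3 f = inj₁ (common-antipode uv e f)

  antipodal-within4 : Connected D → ∀ {u v} → Dist _~_ u v 3 → Within D 4 u v
  antipodal-within4 conn {u} {v} uv = along-walk step end (proj₂ (conn u v)) (close within-refl)
    where
    step : ∀ {w w'} → Near u v w → D w w' → Within D 4 u v ⊎ Near u v w'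
    step {w' = w'} near d with near-either uv w'
    ... | inj₁ r            = inj₁ r
    ... | inj₂ (inj₁ near′) = inj₂ near′
    ... | inj₂ (inj₂ far)   = inj₁ (near-D-near uv near d far)
    end : Near u v v → Within D 4 u v
    end (close p)    = weaken p
    end (beside e _) = ⊥-elim (shortcut uv (edge e))

  Beyond : V → V → V → Set
  Beyond x y w = D x w × y ~ w

  within5-via-D-neighbour : Connected D → ∀ {x y w} → D x w → D y w ⊎ Dist _~_ y w 3 →
                            Within D 5 x y
  within5-via-D-neighbour conn xw (inj₁ yw) = weaken (edge xw ⊕ edge (dist-sym yw))
  within5-via-D-neighbour conn xw (inj₂ yw) =
    edge xw ⊕ within-reverse dist-sym (antipodal-within4 conn yw)

  near-or-beyond : Connected D → ∀ {x y} → x ~ y → ∀ w →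
                   Within D 5 x y ⊎ Within _~_ 1 x w ⊎ Beyond x y w
  near-or-beyond conn {x} {y} xy w with view x w | view y w
  ... | is0 e | _     = inj₂ (inj₁ (weaken (Dist⇒within e)))
  ... | is1 e | _     = inj₂ (inj₁ (Dist⇒within e))
  ... | is2 e | is0 f = ⊥-elim (triangle (~⇒Dist-1 xy) f e)
  ... | is2 e | is1 f = inj₂ (inj₂ (e , Dist-1⇒R f))
  ... | is2 e | is2 f = inj₁ (within5-via-D-neighbour conn e (inj₁ f))
  ... | is2 e | is3 f = inj₁ (within5-via-D-neighbour conn e (inj₂ f))
  ... | is3 e | is0 f = ⊥-elim (triangle (~⇒Dist-1 xy) f e)
  ... | is3 e | is1 f = ⊥-elim (triangle (~⇒Dist-1 xy) f e)
  ... | is3 e | is2 f = inj₁ (antipodal-within4 conn e ⊕ edge (dist-sym f))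
  ... | is3 e | is3 f with Dist-step (dist-sym e)
  ...   | m , wm , mx with view y m
  ...     | is0 g = ⊥-elim (triangle g (~⇒Dist-1 (~-sym wm)) f)
  ...     | is1 g = ⊥-elim (triangle g (~⇒Dist-1 (~-sym wm)) f)
  ...     | is2 g = inj₁ (within5-via-D-neighbour conn (dist-sym mx) (inj₁ g))
  ...     | is3 g = inj₁ (within5-via-D-neighbour conn (dist-sym mx) (inj₂ g))

  ¬antipodal-via : ∀ {c a b} → Within _~_ 1 c a → Within _~_ 1 c b → ¬ Dist _~_ a b 3
  ¬antipodal-via ca cb ab = shortcut ab (within-reverse ~-sym ca ⊕ cb)

  record Straddle (x y : V) : Set where
    field
      a b       : V
      x-a       : D x a
      y~a       : y ~ a
      y-b       : D y b
      x~b       : x ~ b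
      antipodal : Dist _~_ a b 3

  straddle-from : Connected D → ∀ {x y a b} → x ~ y → Beyond x y a → Dist _~_ a b 3 →
                  Within D 5 x y ⊎ Straddle x y
  straddle-from conn {a = a} {b} xy (xa , ya) ab with near-or-beyond conn (~-sym xy) b
  ... | inj₁ r              = inj₁ (within-reverse dist-sym r)
  ... | inj₂ (inj₁ yb)      = contradiction ab (¬antipodal-via (edge ya) yb)
  ... | inj₂ (inj₂ (yb , xb)) =
    inj₂ record { a = a ; b = b ; x-a = xa ; y~a = ya ; y-b = yb ; x~b = xb ; antipodal = ab }

  straddle : Connected D → ∀ {x y p q} → x ~ y → Dist _~_ p q 3 → Within D 5 x y ⊎ Straddle x y
  straddle conn xy pq with near-or-beyond conn xy _ | near-or-beyond conn xy _
  ... | inj₁ r               | _                    = inj₁ r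
  ... | _                    | inj₁ r               = inj₁ r
  ... | inj₂ (inj₁ xp)       | inj₂ (inj₁ xq)       = contradiction pq (¬antipodal-via xp xq)
  ... | inj₂ (inj₂ beyond-p) | _                    = straddle-from conn xy beyond-p pq
  ... | inj₂ (inj₁ _)        | inj₂ (inj₂ beyond-q) = straddle-from conn xy beyond-q (dist-sym pq)

  module _ (conn : Connected D) {x y : V} (xy : x ~ y) (s : Straddle x y) where
    open Straddle s

    central : ∀ {w} → x ~ w → y ~ w → Within D 2 x w ⊎ Within D 2 w y
    central {w} xw yw with w ~? b
    ... | yes wb = inj₁ (edge x-a ⊕ edge (Dist-2-intro a≢w a≁w (~-sym y~a) yw))
      where
      a≢w : a ≢ w
      a≢w refl = shortcut antipodal (edge wb)
      a≁w : ¬ a ~ w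
      a≁w aw = shortcut antipodal (edge aw ⊕ edge wb)
    ... | no w≁b = inj₂ (edge (Dist-2-intro w≢b w≁b (~-sym xw) x~b) ⊕ edge (dist-sym y-b))
      where
      w≢b : w ≢ b
      w≢b refl = shortcut y-b (edge yw)

    reach : ∀ w → Within D 5 x y ⊎ Within D 2 x w ⊎ Within D 2 w y
    reach w with near-or-beyond conn xy w | near-or-beyond conn (~-sym xy) w
    ... | inj₁ r               | _                    = inj₁ r
    ... | _                    | inj₁ r               = inj₁ (within-reverse dist-sym r)
    ... | inj₂ (inj₂ (xw , _)) | _                    = inj₂ (inj₁ (weaken (edge xw)))
    ... | _                    | inj₂ (inj₂ (yw , _)) = inj₂ (inj₂ (weaken (edge (dist-sym yw))))
    ... | inj₂ (inj₁ xw)       | inj₂ (inj₁ yw) with within₁-split xw | within₁-split yw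
    ...   | inj₁ refl | _         = inj₂ (inj₁ within-refl)
    ...   | _         | inj₁ refl = inj₂ (inj₂ within-refl)
    ...   | inj₂ x~w  | inj₂ y~w  = inj₂ (central x~w y~w)

    adjacent-within5 : Within D 5 x y
    adjacent-within5 = along-walk step weaken (proj₂ (conn x y)) within-refl
      where
      step : ∀ {w w'} → Within D 2 x w → D w w' → Within D 5 x y ⊎ Within D 2 x w'
      step {w' = w'} p d with reach w'
      ... | inj₁ r          = inj₁ r
      ... | inj₂ (inj₁ q)   = inj₂ q
      ... | inj₂ (inj₂ q)   = inj₁ (p ⊕ edge d ⊕ q)

theorem2p8 : (n : ℕ) (G : Graph n) →
    DiamEq (Adj G) 3 → Connected (D₂ G) → DiamLe (D₂ G) 5
theorem2p8 n G (diam≤3 , _ , _ , pq) conn = within5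
  where
  open Diameter≤3 G diam≤3
  within5 : ∀ u v → Within D 5 u v
  within5 u v with view u v
  ... | is0 (nil , _) = within-refl
  ... | is2 uv        = weaken (edge uv)
  ... | is3 uv        = weaken (antipodal-within4 conn uv)
  ... | is1 uv with straddle conn (Dist-1⇒R uv) pq
  ...   | inj₁ r = r
  ...   | inj₂ s = adjacent-within5 conn (Dist-1⇒R uv) s
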